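{- Let $k\ge 2$, $G=\Theta(2,2,2k)$, and let $L$ be an $m$-assignment for $G$ with $m\ge 4$. If there is an edge $wz\in E(G)$ and colors $x\in L(w)\setminus L(z)$ and $y\in L(z)\setminus L(w)$, then there are at least $(m-1)^{2k-1}(m-2)^2$ proper $L$-colorings of $G$ that color $w$ with $x$ and $z$ with $y$.
   Context: $\Theta(l_1,l_2,l_3)$ is the graph of two end vertices joined by three internally disjoint paths of lengths $l_1,l_2,l_3$. An $m$-assignment $L$ gives each vertex a set of $m$ colors; a proper $L$-coloring is a proper coloring $f$ with $f(v)\in L(v)$ for all $v$. -}

module Defs where

open import Data.Nat using (ℕ; zero; suc; _+_; _*_; _≤_)
open import Data.Fin using (Fin; toℕ)
open import Data.Vec using (Vec; lookup)
open import Data.List using (List; length)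
open import Data.List.Membership.Propositional using (_∈_)
open import Data.List.Relation.Unary.Unique.Propositional using (Unique)
open import Data.Sum using (_⊎_)
open import Data.Product using (_×_)
open import Relation.Binary.PropositionalEquality using (_≡_; _≢_)

-- Θ(2,2,2k) on vertex set Fin (2k+3), labelled by toℕ:
--   0 and 1 : the two end vertices,
--   2       : middle vertex of the first path of length 2   (0 - 2 - 1),
--   3       : middle vertex of the second path of length 2  (0 - 3 - 1),
--   4 .. 2k+2 : the 2k-1 internal vertices of the path of length 2k
--               (0 - 4 - 5 - ... - (2k+2) - 1).
ThetaSize : ℕ → ℕ
ThetaSize k = 2 * k + 3

data ThetaEdge (k : ℕ) : ℕ → ℕ → Set where
  p1a : ThetaEdge k 0 2
  p1b : ThetaEdge k 2 1
  p2a : ThetaEdge k 0 3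
  p2b : ThetaEdge k 3 1
  p3start : ThetaEdge k 0 4
  p3mid : ∀ i → 4 ≤ i → suc i ≤ 2 * k + 2 → ThetaEdge k i (suc i)
  p3end : ThetaEdge k (2 * k + 2) 1

Adj : (k : ℕ) → Fin (ThetaSize k) → Fin (ThetaSize k) → Set
Adj k u v = ThetaEdge k (toℕ u) (toℕ v) ⊎ ThetaEdge k (toℕ v) (toℕ u)

IsAssignment : (n m : ℕ) → (Fin n → List ℕ) → Set
IsAssignment n m L = ∀ v → Unique (L v) × length (L v) ≡ m

IsProperLColoring : (k : ℕ) → (Fin (ThetaSize k) → List ℕ) → Vec ℕ (ThetaSize k) → Set
IsProperLColoring k L f =
  (∀ u v → Adj k u v → lookup f u ≢ lookup f v) × (∀ v → lookup f v ∈ L v)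

{-# OPTIONS --safe #-}
module Submission where

-- Colour w with x and z with y. Θ(2,2,2k) is a cycle of length 2k + 2 through the edge wz
-- (the long path and one short path) together with an ear: the middle vertex of the other
-- short path, adjacent to both end vertices. Colour the rest of the cycle greedily, walking
-- from z away from w: each vertex has one coloured neighbour, hence at least m − 1 choices,
-- except the last, which also sees w and so has at least m − 2; the ear, coloured last, sees
-- two coloured vertices. That makes (m − 1)^(2k − 1) (m − 2)^2 sequences of choices, and
-- different sequences give different colourings.

open import Defs
open import Data.Fin using (Fin; toℕ; fromℕ<)
open import Data.Fin.Properties using (toℕ-injective; toℕ-fromℕ<; toℕ<n)
open import Data.List using (List; []; _∷_; _++_; length; map; filter; concatMap; applyDownFrom)
open import Data.List.Properties using (length-++; length-map)
open import Data.List.Membership.Propositional using (_∈_; _∉_; find)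
open import Data.List.Membership.Propositional.Properties
  using (∈-∃++; ∈-++⁻; ∈-++⁺ˡ; ∈-++⁺ʳ; ∈-filter⁻; ∈-concatMap⁻; ∈-map⁺; ∈-applyDownFrom⁺; ∈-applyDownFrom⁻)
open import Data.List.Relation.Binary.Disjoint.Propositional using (Disjoint)
open import Data.List.Relation.Unary.All as All using (All; []; _∷_)
import Data.List.Relation.Unary.All.Properties as All
open import Data.List.Relation.Unary.AllPairs as AllPairs using ([]; _∷_)
import Data.List.Relation.Unary.AllPairs.Properties as AllPairs
open import Data.List.Relation.Unary.Any using (here; there)
open import Data.List.Relation.Unary.Unique.Propositional using (Unique)
import Data.List.Relation.Unary.Unique.Propositional.Properties as Unique
open import Data.Nat using (ℕ; zero; suc; _+_; _*_; _∸_; _^_; _≤_; _<_; z≤n; s≤s; s≤s⁻¹; _≤?_; _≟_)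
open import Data.Nat.DivMod using (_%_; m<n⇒m%n≡m; n%n≡0; [m+n]%n≡m%n; m%n<n)
open import Data.Nat.Properties
open import Data.Product as Product using (_×_; Σ; ∃; _,_; proj₁; proj₂)
open import Data.Sum as Sum using (_⊎_; inj₁; inj₂)
open import Data.Unit using (⊤; tt)
open import Data.Vec using (Vec; lookup; replicate; _[_]≔_)
open import Data.Vec.Properties using (lookup∘update; lookup∘update′; lookup-replicate)
open import Function using (_∘_)
open import Relation.Binary.Definitions using (DecidableEquality)
open import Relation.Binary.PropositionalEquality
open import Relation.Nullary using (yes; no; contradiction)

Unique-⊆⇒length≤ : {A : Set} {xs ys : List A} → Unique xs → (∀ {u} → u ∈ xs → u ∈ ys) →
                   length xs ≤ length ys
Unique-⊆⇒length≤ [] _ = z≤n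
Unique-⊆⇒length≤ {xs = x ∷ xs} (x≢xs ∷ xs!) xs⊆ys with ys₁ , ys₂ , refl ← ∈-∃++ (xs⊆ys (here refl)) =
  begin
    suc (length xs)                ≤⟨ s≤s (Unique-⊆⇒length≤ xs! xs⊆ys₁++ys₂) ⟩
    suc (length (ys₁ ++ ys₂))      ≡⟨ cong suc (length-++ ys₁) ⟩
    suc (length ys₁ + length ys₂)  ≡⟨ sym (+-suc (length ys₁) (length ys₂)) ⟩
    length ys₁ + length (x ∷ ys₂)  ≡⟨ sym (length-++ ys₁) ⟩
    length (ys₁ ++ x ∷ ys₂)        ∎
  where
  open ≤-Reasoning
  xs⊆ys₁++ys₂ : ∀ {u} → u ∈ xs → u ∈ ys₁ ++ ys₂
  xs⊆ys₁++ys₂ u∈xs with ∈-++⁻ ys₁ (xs⊆ys (there u∈xs))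
  ... | inj₁ u∈ys₁         = ∈-++⁺ˡ u∈ys₁
  ... | inj₂ (here refl)   = contradiction refl (All.lookup x≢xs u∈xs)
  ... | inj₂ (there u∈ys₂) = ∈-++⁺ʳ ys₁ u∈ys₂

module _ {A : Set} (_≟_ : DecidableEquality A) where
  open import Data.List.Membership.DecPropositional _≟_ using (_∈?_; _∉?_)

  length-filter-∉ : ∀ {xs} ys → Unique xs →
                    length xs ≤ length (filter (_∉? ys) xs) + length ys
  length-filter-∉ {xs} ys xs! =
    ≤-trans (split xs) (+-monoʳ-≤ _ (Unique-⊆⇒length≤ (Unique.filter⁺ (_∈? ys) xs!) used⊆ys))
    where
    used⊆ys : ∀ {u} → u ∈ filter (_∈? ys) xs → u ∈ ys
    used⊆ys = proj₂ ∘ ∈-filter⁻ (_∈? ys) {xs = xs}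

    split : ∀ xs → length xs ≤ length (filter (_∉? ys) xs) + length (filter (_∈? ys) xs)
    split [] = z≤n
    split (x ∷ xs) with x ∈? ys
    ... | yes _ = ≤-trans (s≤s (split xs)) (≤-reflexive (sym (+-suc _ _)))
    ... | no _ = s≤s (split xs)

length-concatMap-≥ : {A B : Set} (f : A → List B) {N : ℕ} → (∀ a → N ≤ length (f a)) →
                     ∀ xs → length xs * N ≤ length (concatMap f xs)
length-concatMap-≥ f f≥N [] = z≤n
length-concatMap-≥ f {N} f≥N (x ∷ xs) = begin
  N + length xs * N                       ≤⟨ +-mono-≤ (f≥N x) (length-concatMap-≥ f f≥N xs) ⟩
  length (f x) + length (concatMap f xs)  ≡⟨ sym (length-++ (f x)) ⟩
  length (concatMap f (x ∷ xs))           ∎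
  where open ≤-Reasoning

module Greedy {n : ℕ} {C : Set} (_≟_ : DecidableEquality C) (L : Fin n → List C) where
  open import Data.List.Membership.DecPropositional _≟_ using (_∉?_)

  Step : Set
  Step = Fin n × List (Fin n)

  vertices : List Step → List (Fin n)
  vertices = map proj₁

  available : Vec C n → Step → List C
  available g (v , cs) = filter (_∉? map (lookup g) cs) (L v)

  extensions : List Step → Vec C n → List (Vec C n)
  extensions [] g = g ∷ []
  extensions ((v , cs) ∷ st) g = concatMap (λ c → extensions st (g [ v ]≔ c)) (available g (v , cs))

  GreedyOrder : List (Fin n) → List Step → Set
  GreedyOrder done [] = ⊤
  GreedyOrder done ((v , cs) ∷ st) = v ∉ done × All (_∈ done) cs × GreedyOrder (v ∷ done) st

  Respects : Vec C n → Step → Set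
  Respects f (v , cs) = lookup f v ∈ L v × All (λ c → lookup f c ≢ lookup f v) cs

  greedyBound : ℕ → List Step → ℕ
  greedyBound m [] = 1
  greedyBound m ((v , cs) ∷ st) = (m ∸ length cs) * greedyBound m st

  ∈-extensions⁻ : ∀ {v cs st g f} → f ∈ extensions ((v , cs) ∷ st) g →
                  ∃ λ c → c ∈ available g (v , cs) × f ∈ extensions st (g [ v ]≔ c)
  ∈-extensions⁻ {v} {cs} {st} {g} f∈ =
    find (∈-concatMap⁻ (λ c → extensions st (g [ v ]≔ c)) {xs = available g (v , cs)} f∈)

  done∉vertices : ∀ {done} st → GreedyOrder done st → ∀ {u} → u ∈ done → u ∉ vertices st
  done∉vertices ((v , cs) ∷ st) (v∉ , _ , _) u∈ (here refl) = v∉ u∈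
  done∉vertices ((v , cs) ∷ st) (v∉ , _ , ord) u∈ (there p) = done∉vertices st ord (there u∈) p

  extensions-agree : ∀ st {g f} → f ∈ extensions st g →
                     ∀ {u} → u ∉ vertices st → lookup f u ≡ lookup g u
  extensions-agree [] (here refl) _ = refl
  extensions-agree ((v , cs) ∷ st) {g} f∈ {u} u∉ with c , _ , f∈′ ← ∈-extensions⁻ {st = st} f∈ =
    trans (extensions-agree st f∈′ (u∉ ∘ there)) (lookup∘update′ (u∉ ∘ here) g c)

  extensions-colour : ∀ {done v cs} st {g f} → GreedyOrder done ((v , cs) ∷ st) →
                      ∀ {c} → f ∈ extensions st (g [ v ]≔ c) → lookup f v ≡ c
  extensions-colour {v = v} st {g} (_ , _ , ord) {c} f∈ =
    trans (extensions-agree st f∈ (done∉vertices st ord (here refl))) (lookup∘update v g c)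

  extensions-respect : ∀ {done} st {g f} → GreedyOrder done st → f ∈ extensions st g → All (Respects f) st
  extensions-respect [] _ _ = []
  extensions-respect {done} ((v , cs) ∷ st) {g} {f} ord@(v∉ , cs⊆done , ord′) f∈
    with c , c∈ , f∈′ ← ∈-extensions⁻ {st = st} f∈ =
    (subst (_∈ L v) (sym fv≡c) c∈L , All.tabulate avoids) ∷ extensions-respect st ord′ f∈′
    where
    c∈L : c ∈ L v
    c∈L = proj₁ (∈-filter⁻ (_∉? map (lookup g) cs) {xs = L v} c∈)
    c∉ : c ∉ map (lookup g) cs
    c∉ = proj₂ (∈-filter⁻ (_∉? map (lookup g) cs) {xs = L v} c∈)
    fv≡c : lookup f v ≡ c
    fv≡c = extensions-colour st ord f∈′
    avoids : ∀ {u} → u ∈ cs → lookup f u ≢ lookup f v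
    avoids {u} u∈cs fu≡fv = c∉ (subst (_∈ map (lookup g) cs) gu≡c (∈-map⁺ (lookup g) u∈cs))
      where
      u∈done : u ∈ done
      u∈done = All.lookup cs⊆done u∈cs
      gu≡c : lookup g u ≡ c
      gu≡c = begin
        lookup g u               ≡⟨ sym (lookup∘update′ (λ u≡v → v∉ (subst (_∈ done) u≡v u∈done)) g c) ⟩
        lookup (g [ v ]≔ c) u    ≡⟨ sym (extensions-agree st f∈′ (done∉vertices st ord′ (there u∈done))) ⟩
        lookup f u               ≡⟨ fu≡fv ⟩
        lookup f v               ≡⟨ fv≡c ⟩
        c                        ∎
        where open ≡-Reasoning

  extensions-unique : (∀ v → Unique (L v)) → ∀ {done} st g → GreedyOrder done st → Unique (extensions st g)
  extensions-unique L! [] g _ = [] ∷ []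
  extensions-unique L! ((v , cs) ∷ st) g ord@(_ , _ , ord′) =
    Unique.concat⁺ (All.map⁺ (All.tabulate (λ _ → extensions-unique L! st _ ord′)))
                   (AllPairs.map⁺ (AllPairs.map disjoint (Unique.filter⁺ _ (L! v))))
    where
    disjoint : ∀ {c c′} → c ≢ c′ → Disjoint (extensions st (g [ v ]≔ c)) (extensions st (g [ v ]≔ c′))
    disjoint c≢c′ (f∈ , f∈′) = c≢c′ (trans (sym (extensions-colour st ord f∈)) (extensions-colour st ord f∈′))

  extensions-length : ∀ {m} → (∀ v → Unique (L v)) → (∀ v → length (L v) ≡ m) →
                      ∀ st g → greedyBound m st ≤ length (extensions st g)
  extensions-length L! L-length [] g = ≤-refl
  extensions-length {m} L! L-length ((v , cs) ∷ st) g = begin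
    (m ∸ length cs) * greedyBound m st  ≤⟨ *-monoˡ-≤ (greedyBound m st) enough-colours ⟩
    length cols * greedyBound m st      ≤⟨ length-concatMap-≥ branch branch-length cols ⟩
    length (concatMap branch cols)      ∎
    where
    open ≤-Reasoning
    cols : List C
    cols = available g (v , cs)
    branch : C → List (Vec C n)
    branch c = extensions st (g [ v ]≔ c)
    branch-length : ∀ c → greedyBound m st ≤ length (branch c)
    branch-length c = extensions-length L! L-length st (g [ v ]≔ c)
    enough-colours : m ∸ length cs ≤ length cols
    enough-colours = m≤n+o⇒m∸n≤o m (length cs) (begin
      m                                       ≡⟨ sym (L-length v) ⟩
      length (L v)                            ≤⟨ length-filter-∉ _≟_ (map (lookup g) cs) (L! v) ⟩
      length cols + length (map (lookup g) cs) ≡⟨ cong (length cols +_) (length-map (lookup g) cs) ⟩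
      length cols + length cs                 ≡⟨ +-comm (length cols) (length cs) ⟩
      length cs + length cols                 ∎)

module _ {V : Set} where

  record IsCycle (ℓ : ℕ) (c : ℕ → V) : Set where
    field
      periodic  : ∀ i → c (i + ℓ) ≡ c i
      injective : ∀ {i j} → i < ℓ → j < ℓ → c i ≡ c j → i ≡ j

  OnCycle : ℕ → (ℕ → V) → V → Set
  OnCycle ℓ c u = ∃ λ i → i < ℓ × u ≡ c i

  CycleEdge : ℕ → (ℕ → V) → V → V → Set
  CycleEdge ℓ c u v = ∃ λ i → i < ℓ × u ≡ c i × v ≡ c (suc i)

  rotate : (ℕ → V) → ℕ → ℕ → V
  rotate c j t = c (j + t)

rotation-offset : ∀ {ℓ i j} → i < ℓ → j < ℓ → ∃ λ t → t < ℓ × (j + t ≡ i ⊎ j + t ≡ i + ℓ)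
rotation-offset {ℓ} {i} {j} i<ℓ j<ℓ with j ≤? i
... | yes j≤i = i ∸ j , ≤-<-trans (m∸n≤m i j) i<ℓ , inj₁ (m+[n∸m]≡n j≤i)
... | no j≰i = i + ℓ ∸ j , offset<ℓ , inj₂ (m+[n∸m]≡n j≤i+ℓ)
  where
  j≤i+ℓ : j ≤ i + ℓ
  j≤i+ℓ = ≤-trans (<⇒≤ j<ℓ) (m≤n+m ℓ i)
  offset<ℓ : i + ℓ ∸ j < ℓ
  offset<ℓ = subst (i + ℓ ∸ j <_) (m+n∸m≡n j ℓ) (∸-monoˡ-< (+-monoˡ-< ℓ (≰⇒> j≰i)) j≤i+ℓ)

module _ {V : Set} {ℓ : ℕ} {c : ℕ → V} (cycle : IsCycle ℓ c) where
  open IsCycle cycle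

  rotate-suc : ∀ j t → rotate c (suc j) t ≡ rotate c j (suc t)
  rotate-suc j t = cong c (sym (+-suc j t))

  rotate-wrap : ∀ j {t} → suc t ≡ ℓ → rotate c (suc j) t ≡ rotate c j 0
  rotate-wrap j {t} 1+t≡ℓ = begin
    c (suc j + t)  ≡⟨ rotate-suc j t ⟩
    c (j + suc t)  ≡⟨ cong (λ i → c (j + i)) 1+t≡ℓ ⟩
    c (j + ℓ)      ≡⟨ periodic j ⟩
    c j            ≡⟨ cong c (sym (+-identityʳ j)) ⟩
    c (j + 0)      ∎
    where open ≡-Reasoning

  rotate-injective : ∀ j {t u} → t < ℓ → u < ℓ → rotate c j t ≡ rotate c j u → t ≡ u
  rotate-injective zero = injective
  rotate-injective (suc j) {t} {u} t<ℓ u<ℓ eq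
    with m≤n⇒m<n∨m≡n t<ℓ | m≤n⇒m<n∨m≡n u<ℓ
  ... | inj₁ 1+t<ℓ | inj₁ 1+u<ℓ =
    suc-injective (rotate-injective j 1+t<ℓ 1+u<ℓ (trans (sym (rotate-suc j t)) (trans eq (rotate-suc j u))))
  ... | inj₂ 1+t≡ℓ | inj₂ 1+u≡ℓ = suc-injective (trans 1+t≡ℓ (sym 1+u≡ℓ))
  ... | inj₁ 1+t<ℓ | inj₂ 1+u≡ℓ = contradiction
    (rotate-injective j 1+t<ℓ (≤-<-trans z≤n t<ℓ)
      (trans (sym (rotate-suc j t)) (trans eq (rotate-wrap j 1+u≡ℓ)))) λ ()
  ... | inj₂ 1+t≡ℓ | inj₁ 1+u<ℓ = contradiction
    (rotate-injective j (≤-<-trans z≤n u<ℓ) 1+u<ℓ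
      (trans (sym (rotate-wrap j 1+t≡ℓ)) (trans eq (rotate-suc j u)))) λ ()

  rotate-isCycle : ∀ j → IsCycle ℓ (rotate c j)
  rotate-isCycle j = record
    { periodic  = λ t → trans (cong c (sym (+-assoc j t ℓ))) (periodic (j + t))
    ; injective = rotate-injective j
    }

  rotation-agrees : ∀ {i} j t → j + t ≡ i ⊎ j + t ≡ i + ℓ → rotate c j t ≡ c i
  rotation-agrees j t (inj₁ j+t≡i) = cong c j+t≡i
  rotation-agrees {i} j t (inj₂ j+t≡i+ℓ) = trans (cong c j+t≡i+ℓ) (periodic i)

  rotate-onCycle : ∀ {j u} → j < ℓ → OnCycle ℓ c u → OnCycle ℓ (rotate c j) u
  rotate-onCycle {j} j<ℓ (i , i<ℓ , u≡ci) with t , t<ℓ , offset ← rotation-offset i<ℓ j<ℓ =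
    t , t<ℓ , trans u≡ci (sym (rotation-agrees j t offset))

  rotate-cycleEdge : ∀ {j u v} → j < ℓ → CycleEdge ℓ c u v → CycleEdge ℓ (rotate c j) u v
  rotate-cycleEdge {j} j<ℓ (i , i<ℓ , u≡ci , v≡c1+i) with t , t<ℓ , offset ← rotation-offset i<ℓ j<ℓ =
    t , t<ℓ , trans u≡ci (sym (rotation-agrees j t offset)) ,
    trans v≡c1+i (sym (rotation-agrees j (suc t) (Sum.map step step offset)))
    where
    step : ∀ {k} → j + t ≡ k → j + suc t ≡ suc k
    step j+t≡k = trans (+-suc j t) (cong suc j+t≡k)

record EarCycle (n r : ℕ) : Set where
  field
    cyc      : ℕ → Fin n
    isCycle  : IsCycle (3 + r) cyc
    ear      : Fin n
    ear-off  : ∀ i → cyc i ≢ ear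
    foot₁    : Fin n
    foot₂    : Fin n
    foot₁-on : OnCycle (3 + r) cyc foot₁
    foot₂-on : OnCycle (3 + r) cyc foot₂
    spanning : ∀ v → OnCycle (3 + r) cyc v ⊎ v ≡ ear

data EarCycleEdge {n r} (G : EarCycle n r) (u v : Fin n) : Set where
  along : CycleEdge (3 + r) (EarCycle.cyc G) u v → EarCycleEdge G u v
  ear₁  : u ≡ EarCycle.ear G → v ≡ EarCycle.foot₁ G → EarCycleEdge G u v
  ear₂  : u ≡ EarCycle.ear G → v ≡ EarCycle.foot₂ G → EarCycleEdge G u v

module _ {n r} (G : EarCycle n r) {j} (j<ℓ : j < 3 + r) where
  open EarCycle G

  rotateEarCycle : EarCycle n r
  rotateEarCycle = record G
    { cyc      = rotate cyc j
    ; isCycle  = rotate-isCycle isCycle j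
    ; ear-off  = λ t → ear-off (j + t)
    ; foot₁-on = rotate-onCycle isCycle j<ℓ foot₁-on
    ; foot₂-on = rotate-onCycle isCycle j<ℓ foot₂-on
    ; spanning = Sum.map₁ (rotate-onCycle isCycle j<ℓ) ∘ spanning
    }

  rotate-earCycleEdge : ∀ {u v} → EarCycleEdge G u v → EarCycleEdge rotateEarCycle u v
  rotate-earCycleEdge (along e)  = along (rotate-cycleEdge isCycle j<ℓ e)
  rotate-earCycleEdge (ear₁ p q) = ear₁ p q
  rotate-earCycleEdge (ear₂ p q) = ear₂ p q

module _ {n : ℕ} {C : Set} (L : Fin n → List C) where

  ProperLColouring : (Fin n → Fin n → Set) → Vec C n → Set
  ProperLColouring E f = (∀ u v → E u v → lookup f u ≢ lookup f v) × (∀ v → lookup f v ∈ L v)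

  Colourings : (Fin n → Fin n → Set) → Fin n → Fin n → C → C → ℕ → Set
  Colourings E a b x y N = Σ (List (Vec C n)) λ fs →
    Unique fs × N ≤ length fs × All (λ f → ProperLColouring E f × lookup f a ≡ x × lookup f b ≡ y) fs

  colourings-⊆ : ∀ {E E′ a b x y N} → (∀ {u v} → E u v → E′ u v ⊎ E′ v u) →
                 Colourings E′ a b x y N → Colourings E a b x y N
  colourings-⊆ {E} {E′} E⊆E′ (fs , fs! , N≤ , fs-ok) =
    fs , fs! , N≤ , All.map (λ {f} → Product.map₁ (Product.map₁ (restrict {f}))) fs-ok
    where
    restrict : ∀ {f : Vec C n} → (∀ u v → E′ u v → lookup f u ≢ lookup f v) →
               ∀ u v → E u v → lookup f u ≢ lookup f v
    restrict sep u v e = Sum.[ sep u v , (λ e′ fu≡fv → sep v u e′ (sym fu≡fv)) ] (E⊆E′ e)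

  colourings-swap : ∀ {E a b x y N} → Colourings E b a y x N → Colourings E a b x y N
  colourings-swap (fs , fs! , N≤ , fs-ok) =
    fs , fs! , N≤ , All.map (λ (proper , fb , fa) → proper , fa , fb) fs-ok

module _ {n : ℕ} {C : Set} (_≟_ : DecidableEquality C) (L : Fin n → List C)
         {m : ℕ} (L! : ∀ v → Unique (L v)) (L-length : ∀ v → length (L v) ≡ m) where
  open Greedy _≟_ L

  chain : (ℕ → Fin n) → ℕ → ℕ → List Step
  chain p t zero    = []
  chain p t (suc r) = (p (suc t) , p t ∷ []) ∷ chain p (suc t) r

  ∈-chain : ∀ p {t r i} → t ≤ i → i < t + r → (p (suc i) , p i ∷ []) ∈ chain p t r
  ∈-chain p {t} {zero} {i} t≤i i<t+0 = contradiction t≤i (<⇒≱ (subst (i <_) (+-identityʳ t) i<t+0))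
  ∈-chain p {t} {suc r} {i} t≤i i<t+r with m≤n⇒m<n∨m≡n t≤i
  ... | inj₂ refl = here refl
  ... | inj₁ t<i  = there (∈-chain p t<i (subst (i <_) (+-suc t r) i<t+r))

  greedyBound-chain : ∀ p t r rest →
                      greedyBound m (chain p t r ++ rest) ≡ (m ∸ 1) ^ r * greedyBound m rest
  greedyBound-chain p t zero    rest = sym (+-identityʳ (greedyBound m rest))
  greedyBound-chain p t (suc r) rest = trans (cong ((m ∸ 1) *_) (greedyBound-chain p (suc t) r rest))
                                             (sym (*-assoc (m ∸ 1) ((m ∸ 1) ^ r) (greedyBound m rest)))

  module _ {r} (G : EarCycle n r) where
    open EarCycle G
    open IsCycle isCycle

    -- In the closing step cyc 0 stands for cyc (3 + r), the cycle successor of cyc (2 + r).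
    earCycleSteps : List Step
    earCycleSteps =
      chain cyc 1 r ++ (cyc (2 + r) , cyc (1 + r) ∷ cyc 0 ∷ []) ∷ (ear , foot₁ ∷ foot₂ ∷ []) ∷ []

    cyc∉applyDownFrom : ∀ {i} → i < 3 + r → cyc i ∉ applyDownFrom cyc i
    cyc∉applyDownFrom i<ℓ ci∈ with t , t<i , ci≡ct ← ∈-applyDownFrom⁻ cyc ci∈ =
      <⇒≢ t<i (sym (injective i<ℓ (<-trans t<i i<ℓ) ci≡ct))

    onCycle⇒∈applyDownFrom : ∀ {u} → OnCycle (3 + r) cyc u → u ∈ applyDownFrom cyc (3 + r)
    onCycle⇒∈applyDownFrom (i , i<ℓ , refl) = ∈-applyDownFrom⁺ cyc i<ℓ

    chain-order : ∀ t k {rest} → t + k < 3 + r → GreedyOrder (applyDownFrom cyc (suc (t + k))) rest →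
                  GreedyOrder (applyDownFrom cyc (suc t)) (chain cyc t k ++ rest)
    chain-order t zero _ ord = subst (λ i → GreedyOrder (applyDownFrom cyc (suc i)) _) (+-identityʳ t) ord
    chain-order t (suc k) {rest} t+k<ℓ ord =
      cyc∉applyDownFrom (≤-<-trans (m≤m+n (suc t) k) t+1+k<ℓ) , here refl ∷ [] ,
      chain-order (suc t) k t+1+k<ℓ (subst (λ i → GreedyOrder (applyDownFrom cyc (suc i)) rest) (+-suc t k) ord)
      where
      t+1+k<ℓ : suc t + k < 3 + r
      t+1+k<ℓ = subst (_< 3 + r) (+-suc t k) t+k<ℓ

    earCycleSteps-order : GreedyOrder (applyDownFrom cyc 2) earCycleSteps
    earCycleSteps-order = chain-order 1 r (s≤s (s≤s (n≤1+n r)))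
      ( cyc∉applyDownFrom ≤-refl , here refl ∷ ∈-applyDownFrom⁺ cyc (s≤s z≤n) ∷ []
      , ear-uncoloured , onCycle⇒∈applyDownFrom foot₁-on ∷ onCycle⇒∈applyDownFrom foot₂-on ∷ [] , tt )
      where
      ear-uncoloured : ear ∉ applyDownFrom cyc (3 + r)
      ear-uncoloured ear∈ with t , _ , ear≡ct ← ∈-applyDownFrom⁻ cyc ear∈ = ear-off t (sym ear≡ct)

    module _ {g f} (f∈ : f ∈ extensions earCycleSteps g) where

      respects : ∀ {step} → step ∈ earCycleSteps → Respects f step
      respects = All.lookup (extensions-respect earCycleSteps earCycleSteps-order f∈)

      chain-step : ∀ {i} → i < r → Respects f (cyc (2 + i) , cyc (1 + i) ∷ [])
      chain-step i<r = respects (∈-++⁺ˡ (∈-chain cyc (s≤s z≤n) (s≤s i<r)))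

      closing-step : Respects f (cyc (2 + r) , cyc (1 + r) ∷ cyc 0 ∷ [])
      closing-step = respects (∈-++⁺ʳ (chain cyc 1 r) (here refl))

      ear-step : Respects f (ear , foot₁ ∷ foot₂ ∷ [])
      ear-step = respects (∈-++⁺ʳ (chain cyc 1 r) (there (here refl)))

      walk-separated : ∀ i → i < 2 + r → lookup f (cyc (1 + i)) ≢ lookup f (cyc (2 + i))
      walk-separated i i<2+r with m<1+n⇒m<n∨m≡n i<2+r
      ... | inj₂ refl = λ eq →
        All.head (All.tail (proj₂ closing-step)) (sym (trans eq (cong (lookup f) (periodic 0))))
      ... | inj₁ i<1+r with m<1+n⇒m<n∨m≡n i<1+r
      ...   | inj₁ i<r  = All.head (proj₂ (chain-step i<r))
      ...   | inj₂ refl = All.head (proj₂ closing-step)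

      walk-in-list : ∀ i → i < 1 + r → lookup f (cyc (2 + i)) ∈ L (cyc (2 + i))
      walk-in-list i i<1+r with m<1+n⇒m<n∨m≡n i<1+r
      ... | inj₁ i<r  = proj₁ (chain-step i<r)
      ... | inj₂ refl = proj₁ closing-step

    earCycle-colourings₀ : ∀ {x y} → x ∈ L (cyc 0) → y ∈ L (cyc 1) → x ≢ y →
                           Colourings L (EarCycleEdge G) (cyc 0) (cyc 1) x y ((m ∸ 1) ^ r * (m ∸ 2) ^ 2)
    earCycle-colourings₀ {x} {y} x∈L y∈L x≢y =
      extensions earCycleSteps g , extensions-unique L! earCycleSteps g earCycleSteps-order ,
      subst (_≤ length (extensions earCycleSteps g)) (greedyBound-chain cyc 1 r _)
            (extensions-length L! L-length earCycleSteps g) ,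
      All.tabulate colouring-ok
      where
      g : Vec C n
      g = replicate n x [ cyc 1 ]≔ y

      g-at-0 : lookup g (cyc 0) ≡ x
      g-at-0 = trans (lookup∘update′ (0≢1+n ∘ injective (s≤s z≤n) (s≤s (s≤s z≤n))) (replicate n x) y)
                     (lookup-replicate (cyc 0) x)

      colouring-ok : ∀ {f} → f ∈ extensions earCycleSteps g →
                     ProperLColouring L (EarCycleEdge G) f × lookup f (cyc 0) ≡ x × lookup f (cyc 1) ≡ y
      colouring-ok {f} f∈ = (separated , in-list) , f-at-0 , f-at-1
        where
        agree-on-done : ∀ {u} → u ∈ applyDownFrom cyc 2 → lookup f u ≡ lookup g u
        agree-on-done u∈ = extensions-agree earCycleSteps f∈ (done∉vertices earCycleSteps earCycleSteps-order u∈)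
        f-at-0 : lookup f (cyc 0) ≡ x
        f-at-0 = trans (agree-on-done (there (here refl))) g-at-0
        f-at-1 : lookup f (cyc 1) ≡ y
        f-at-1 = trans (agree-on-done (here refl)) (lookup∘update (cyc 1) (replicate n x) y)

        separated : ∀ u v → EarCycleEdge G u v → lookup f u ≢ lookup f v
        separated _ _ (along (zero , _ , refl , refl))      = λ eq → x≢y (trans (sym f-at-0) (trans eq f-at-1))
        separated _ _ (along (suc i , 1+i<ℓ , refl , refl)) = walk-separated f∈ i (s≤s⁻¹ 1+i<ℓ)
        separated _ _ (ear₁ refl refl) = ≢-sym (All.head (proj₂ (ear-step f∈)))
        separated _ _ (ear₂ refl refl) = ≢-sym (All.head (All.tail (proj₂ (ear-step f∈))))

        in-list : ∀ v → lookup f v ∈ L v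
        in-list v with spanning v
        ... | inj₁ (zero , _ , refl)            = subst (_∈ L (cyc 0)) (sym f-at-0) x∈L
        ... | inj₁ (suc zero , _ , refl)        = subst (_∈ L (cyc 1)) (sym f-at-1) y∈L
        ... | inj₁ (suc (suc i) , 2+i<ℓ , refl) = walk-in-list f∈ i (s≤s⁻¹ (s≤s⁻¹ 2+i<ℓ))
        ... | inj₂ refl                         = proj₁ (ear-step f∈)

  earCycle-colourings : ∀ {r} (G : EarCycle n r) {a b x y} → CycleEdge (3 + r) (EarCycle.cyc G) a b →
                        x ∈ L a → y ∈ L b → x ≢ y →
                        Colourings L (EarCycleEdge G) a b x y ((m ∸ 1) ^ r * (m ∸ 2) ^ 2)
  earCycle-colourings {r} G {x = x} {y} (j , j<ℓ , refl , refl) x∈L y∈L x≢y =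
    colourings-⊆ L (inj₁ ∘ rotate-earCycleEdge G j<ℓ)
      (subst₂ (λ a b → Colourings L (EarCycleEdge G′) a b x y _) first second
        (earCycle-colourings₀ G′ (subst (λ a → x ∈ L a) (sym first) x∈L)
                                 (subst (λ b → y ∈ L b) (sym second) y∈L) x≢y))
    where
    open EarCycle G
    G′ : EarCycle n r
    G′ = rotateEarCycle G j<ℓ
    first : cyc (j + 0) ≡ cyc j
    first = cong cyc (+-identityʳ j)
    second : cyc (j + 1) ≡ cyc (suc j)
    second = cong cyc (+-comm j 1)

-- Middles s s′: the short path through s is put on the cycle, its twin s′ becomes the ear.
data Middles : ℕ → ℕ → Set where
  2-on-cycle : Middles 2 3
  3-on-cycle : Middles 3 2

ear<4 : ∀ {s s′} → Middles s s′ → s′ < 4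
ear<4 2-on-cycle = ≤-refl
ear<4 3-on-cycle = s≤s (s≤s (s≤s z≤n))

middles-distinct : ∀ {s s′} → Middles s s′ → s ≢ s′
middles-distinct 2-on-cycle ()
middles-distinct 3-on-cycle ()

corner : ℕ → ℕ → ℕ
corner s zero          = 1
corner s (suc zero)    = s
corner s (suc (suc _)) = 0

segment : ℕ → ℕ → ℕ → ℕ → ℕ
segment s a zero    i       = corner s i
segment s a (suc r) zero    = a
segment s a (suc r) (suc i) = segment s (suc a) r i

-- cycleLabel r s runs through the cycle 0, 4, 5, …, 3 + r, 1, s of Θ(2,2,r+1), with vertex
-- labels as in ThetaEdge, and is back at 0 at index 3 + r.
cycleLabel : ℕ → ℕ → ℕ → ℕ
cycleLabel r s zero    = 0
cycleLabel r s (suc i) = segment s 4 r i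

-- Both 2 and 3 go to the index of s, so this inverts cycleLabel r s whichever of them s is.
cycleIndex : ℕ → ℕ → ℕ
cycleIndex r 0 = 0
cycleIndex r 1 = 1 + r
cycleIndex r 2 = 2 + r
cycleIndex r 3 = 2 + r
cycleIndex r (suc (suc (suc (suc j)))) = suc j

segment-inner : ∀ s a {r i} → i < r → segment s a r i ≡ a + i
segment-inner s a {suc r} {zero}  _         = sym (+-identityʳ a)
segment-inner s a {suc r} {suc i} (s≤s i<r) = trans (segment-inner s (suc a) i<r) (sym (+-suc a i))

segment-corner : ∀ s a r j → segment s a r (r + j) ≡ corner s j
segment-corner s a zero    j = refl
segment-corner s a (suc r) j = segment-corner s (suc a) r j

segment< : ∀ {s a} r i → s < a → 1 < a → segment s a r i < a + r
segment< {a = a} zero zero          _   1<a = subst (1 <_) (sym (+-identityʳ a)) 1<a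
segment< {a = a} zero (suc zero)    s<a _   = subst (_ <_) (sym (+-identityʳ a)) s<a
segment< {a = a} zero (suc (suc i)) _   1<a = subst (0 <_) (sym (+-identityʳ a)) (<-trans (s≤s z≤n) 1<a)
segment< {a = a} (suc r) zero       _   _   = m<m+n a (s≤s z≤n)
segment< {s} {a} (suc r) (suc i)    s<a 1<a =
  subst (segment s (suc a) r i <_) (sym (+-suc a r)) (segment< r i (m<n⇒m<1+n s<a) (m<n⇒m<1+n 1<a))

module _ {r s : ℕ} where

  cycleLabel-long : ∀ {i} → i < r → cycleLabel r s (suc i) ≡ 4 + i
  cycleLabel-long = segment-inner s 4

  cycleLabel-one : cycleLabel r s (1 + r) ≡ 1
  cycleLabel-one = trans (cong (segment s 4 r) (sym (+-identityʳ r))) (segment-corner s 4 r 0)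

  cycleLabel-middle : cycleLabel r s (2 + r) ≡ s
  cycleLabel-middle = trans (cong (segment s 4 r) (+-comm 1 r)) (segment-corner s 4 r 1)

  cycleLabel-wrap : cycleLabel r s (3 + r) ≡ 0
  cycleLabel-wrap = trans (cong (segment s 4 r) (+-comm 2 r)) (segment-corner s 4 r 2)

cycleLabel-last : ∀ {r s} → 0 < r → cycleLabel r s r ≡ 3 + r
cycleLabel-last {suc r₀} _ = cycleLabel-long (n<1+n r₀)

cycleLabel< : ∀ {r s s′} → Middles s s′ → ∀ i → cycleLabel r s i < 4 + r
cycleLabel< _                zero    = s≤s z≤n
cycleLabel< {r} 2-on-cycle (suc i) = segment< r i (s≤s (s≤s (s≤s z≤n))) (s≤s (s≤s z≤n))
cycleLabel< {r} 3-on-cycle (suc i) = segment< r i ≤-refl (s≤s (s≤s z≤n))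

cycleIndex-middle : ∀ {r s s′} → Middles s s′ → cycleIndex r s ≡ 2 + r
cycleIndex-middle 2-on-cycle = refl
cycleIndex-middle 3-on-cycle = refl

cycleIndex-ear : ∀ {r s s′} → Middles s s′ → cycleIndex r s′ ≡ 2 + r
cycleIndex-ear 2-on-cycle = refl
cycleIndex-ear 3-on-cycle = refl

cycleIndex-cycleLabel : ∀ {r s s′} → Middles s s′ → ∀ {i} → i < 3 + r → cycleIndex r (cycleLabel r s i) ≡ i
cycleIndex-cycleLabel _ {zero} _ = refl
cycleIndex-cycleLabel {r} {s} mid {suc i} 1+i<ℓ with m<1+n⇒m<n∨m≡n (s≤s⁻¹ 1+i<ℓ)
... | inj₂ refl = trans (cong (cycleIndex r) (cycleLabel-middle {r} {s})) (cycleIndex-middle mid)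
... | inj₁ i<1+r with m<1+n⇒m<n∨m≡n i<1+r
...   | inj₁ i<r  = cong (cycleIndex r) (cycleLabel-long {r} {s} i<r)
...   | inj₂ refl = cong (cycleIndex r) (cycleLabel-one {r} {s})

cycleLabel-cycleIndex : ∀ {r s s′} → Middles s s′ → ∀ {u} → u < 4 + r → u ≢ s′ → cycleLabel r s (cycleIndex r u) ≡ u
cycleLabel-cycleIndex _ {0} _ _ = refl
cycleLabel-cycleIndex {r} {s} _ {1} _ _ = cycleLabel-one {r} {s}
cycleLabel-cycleIndex {r} 2-on-cycle {2} _ _ = cycleLabel-middle {r}
cycleLabel-cycleIndex 3-on-cycle {2} _ 2≢s′ = contradiction refl 2≢s′
cycleLabel-cycleIndex 2-on-cycle {3} _ 3≢s′ = contradiction refl 3≢s′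
cycleLabel-cycleIndex {r} 3-on-cycle {3} _ _ = cycleLabel-middle {r}
cycleLabel-cycleIndex {r} {s} _ {suc (suc (suc (suc j)))} 4+j<4+r _ = cycleLabel-long {r} {s} (+-cancelˡ-< 4 j r 4+j<4+r)

cycleIndex< : ∀ {r u} → u < 4 + r → cycleIndex r u < 3 + r
cycleIndex< {r} {0} _ = s≤s z≤n
cycleIndex< {r} {1} _ = s≤s (s≤s (n≤1+n r))
cycleIndex< {r} {2} _ = ≤-refl
cycleIndex< {r} {3} _ = ≤-refl
cycleIndex< {r} {suc (suc (suc (suc j)))} 4+j<4+r = s≤s (m≤n⇒m≤o+n 2 (+-cancelˡ-< 4 j r 4+j<4+r))

CycleLabelEdge : ℕ → ℕ → ℕ → ℕ → Set
CycleLabelEdge r s a b = ∃ λ i → i < 3 + r × a ≡ cycleLabel r s i × b ≡ cycleLabel r s (suc i)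

LabelEdge : ℕ → ℕ → ℕ → ℕ → ℕ → Set
LabelEdge r s s′ a b = CycleLabelEdge r s a b ⊎ (a ≡ s′ × (b ≡ 0 ⊎ b ≡ 1))

module _ {r s : ℕ} where

  one-middle-edge : CycleLabelEdge r s 1 s
  one-middle-edge = 1 + r , s≤s (s≤s (n≤1+n r)) , sym (cycleLabel-one {r} {s}) , sym (cycleLabel-middle {r} {s})

  middle-zero-edge : CycleLabelEdge r s s 0
  middle-zero-edge = 2 + r , ≤-refl , sym (cycleLabel-middle {r} {s}) , sym (cycleLabel-wrap {r} {s})

  start-edge : 0 < r → CycleLabelEdge r s 0 4
  start-edge 0<r = 0 , s≤s z≤n , refl , sym (cycleLabel-long {r} {s} 0<r)

  inner-edge : ∀ {j} → suc j < r → CycleLabelEdge r s (4 + j) (5 + j)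
  inner-edge {j} 1+j<r =
    suc j , s≤s (m≤n⇒m≤o+n 2 (<⇒≤ 1+j<r)) ,
    sym (cycleLabel-long {r} {s} (<-trans (n<1+n j) 1+j<r)) , sym (cycleLabel-long {r} {s} 1+j<r)

  end-edge : 0 < r → CycleLabelEdge r s (3 + r) 1
  end-edge 0<r = r , m≤n⇒m≤o+n 2 ≤-refl , sym (cycleLabel-last {r} {s} 0<r) , sym (cycleLabel-one {r} {s})

module _ {k r : ℕ} (0<r : 0 < r) (last≡ : 2 * k + 2 ≡ 3 + r) where

  path3-inner-edge : ∀ {s i} → 4 ≤ i → suc i ≤ 2 * k + 2 → CycleLabelEdge r s i (suc i)
  path3-inner-edge 4≤i 1+i≤last with j , refl ← m≤n⇒∃[o]m+o≡n 4≤i =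
    inner-edge (+-cancelˡ-≤ 3 (2 + j) r (subst (5 + j ≤_) last≡ 1+i≤last))

  path3-end-edge : ∀ {s} → CycleLabelEdge r s (2 * k + 2) 1
  path3-end-edge {s} = subst (λ a → CycleLabelEdge r s a 1) (sym last≡) (end-edge 0<r)

  thetaEdge⇒labelEdge : ∀ {s s′ a b} → Middles s s′ → ThetaEdge k a b →
                        LabelEdge r s s′ a b ⊎ LabelEdge r s s′ b a
  thetaEdge⇒labelEdge 2-on-cycle p1a = inj₂ (inj₁ middle-zero-edge)
  thetaEdge⇒labelEdge 3-on-cycle p1a = inj₂ (inj₂ (refl , inj₁ refl))
  thetaEdge⇒labelEdge 2-on-cycle p1b = inj₂ (inj₁ one-middle-edge)
  thetaEdge⇒labelEdge 3-on-cycle p1b = inj₁ (inj₂ (refl , inj₂ refl))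
  thetaEdge⇒labelEdge 2-on-cycle p2a = inj₂ (inj₂ (refl , inj₁ refl))
  thetaEdge⇒labelEdge 3-on-cycle p2a = inj₂ (inj₁ middle-zero-edge)
  thetaEdge⇒labelEdge 2-on-cycle p2b = inj₁ (inj₂ (refl , inj₂ refl))
  thetaEdge⇒labelEdge 3-on-cycle p2b = inj₂ (inj₁ one-middle-edge)
  thetaEdge⇒labelEdge _ p3start             = inj₁ (inj₁ (start-edge 0<r))
  thetaEdge⇒labelEdge _ (p3mid i 4≤i 1+i≤) = inj₁ (inj₁ (path3-inner-edge 4≤i 1+i≤))
  thetaEdge⇒labelEdge _ p3end               = inj₁ (inj₁ path3-end-edge)

  thetaEdge-onCycle : ∀ {a b} → ThetaEdge k a b →
                      Σ ℕ λ s → Σ ℕ λ s′ → Middles s s′ × (CycleLabelEdge r s a b ⊎ CycleLabelEdge r s b a)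
  thetaEdge-onCycle p1a                = 2 , 3 , 2-on-cycle , inj₂ middle-zero-edge
  thetaEdge-onCycle p1b                = 2 , 3 , 2-on-cycle , inj₂ one-middle-edge
  thetaEdge-onCycle p2a                = 3 , 2 , 3-on-cycle , inj₂ middle-zero-edge
  thetaEdge-onCycle p2b                = 3 , 2 , 3-on-cycle , inj₂ one-middle-edge
  thetaEdge-onCycle p3start            = 2 , 3 , 2-on-cycle , inj₁ (start-edge 0<r)
  thetaEdge-onCycle (p3mid i 4≤i 1+i≤) = 2 , 3 , 2-on-cycle , inj₁ (path3-inner-edge 4≤i 1+i≤)
  thetaEdge-onCycle p3end              = 2 , 3 , 2-on-cycle , inj₁ path3-end-edge

module Theta (k : ℕ) (1≤k : 1 ≤ k) where

  r : ℕ
  r = 2 * k ∸ 1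

  2k≡1+r : 2 * k ≡ suc r
  2k≡1+r = sym (m+[n∸m]≡n (≤-trans 1≤k (m≤m+n k (k + 0))))

  size≡ : ThetaSize k ≡ 4 + r
  size≡ = trans (cong (_+ 3) 2k≡1+r) (+-comm (suc r) 3)

  last≡ : 2 * k + 2 ≡ 3 + r
  last≡ = trans (cong (_+ 2) 2k≡1+r) (+-comm (suc r) 2)

  0<r : 0 < r
  0<r = ∸-monoˡ-≤ 1 (*-monoʳ-≤ 2 1≤k)

  Vertex : Set
  Vertex = Fin (ThetaSize k)

  module _ {s s′ : ℕ} (middles : Middles s s′) where

    vertexAt : ℕ → Vertex
    vertexAt i = fromℕ< (subst (cycleLabel r s i <_) (sym size≡) (cycleLabel< middles i))

    thetaCycle : ℕ → Vertex
    thetaCycle i = vertexAt (i % (3 + r))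

    toℕ-thetaCycle : ∀ {i} → i ≤ 3 + r → toℕ (thetaCycle i) ≡ cycleLabel r s i
    toℕ-thetaCycle {i} i≤ℓ with m≤n⇒m<n∨m≡n i≤ℓ
    ... | inj₁ i<ℓ  = trans (toℕ-fromℕ< _) (cong (cycleLabel r s) (m<n⇒m%n≡m i<ℓ))
    ... | inj₂ refl = trans (toℕ-fromℕ< _)
                            (trans (cong (cycleLabel r s) (n%n≡0 (3 + r))) (sym (cycleLabel-wrap {r} {s})))

    thetaCycle-at : ∀ {u i} → i ≤ 3 + r → toℕ u ≡ cycleLabel r s i → u ≡ thetaCycle i
    thetaCycle-at i≤ℓ u≡label = toℕ-injective (trans u≡label (sym (toℕ-thetaCycle i≤ℓ)))

    thetaCycle-isCycle : IsCycle (3 + r) thetaCycle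
    thetaCycle-isCycle = record
      { periodic  = λ i → cong vertexAt ([m+n]%n≡m%n i (3 + r))
      ; injective = λ {i} {j} i<ℓ j<ℓ ci≡cj → begin
          i                                  ≡⟨ sym (cycleIndex-cycleLabel middles i<ℓ) ⟩
          cycleIndex r (cycleLabel r s i)    ≡⟨ cong (cycleIndex r) (labels-agree i<ℓ j<ℓ ci≡cj) ⟩
          cycleIndex r (cycleLabel r s j)    ≡⟨ cycleIndex-cycleLabel middles j<ℓ ⟩
          j                                  ∎
      }
      where
      open ≡-Reasoning
      labels-agree : ∀ {i j} → i < 3 + r → j < 3 + r → thetaCycle i ≡ thetaCycle j →
                     cycleLabel r s i ≡ cycleLabel r s j
      labels-agree i<ℓ j<ℓ ci≡cj =
        trans (sym (toℕ-thetaCycle (<⇒≤ i<ℓ))) (trans (cong toℕ ci≡cj) (toℕ-thetaCycle (<⇒≤ j<ℓ)))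

    earVertex : Vertex
    earVertex = fromℕ< (subst (s′ <_) (sym size≡) (m≤n⇒m≤n+o r (ear<4 middles)))

    thetaCycle≢ear : ∀ i → thetaCycle i ≢ earVertex
    thetaCycle≢ear i ci≡ear = middles-distinct middles (begin
      s                       ≡⟨ sym (cycleLabel-middle {r} {s}) ⟩
      cycleLabel r s (2 + r)  ≡⟨ cong (cycleLabel r s) (sym j≡2+r) ⟩
      cycleLabel r s j        ≡⟨ label≡s′ ⟩
      s′                      ∎)
      where
      open ≡-Reasoning
      j : ℕ
      j = i % (3 + r)
      label≡s′ : cycleLabel r s j ≡ s′
      label≡s′ = trans (sym (toℕ-fromℕ< _)) (trans (cong toℕ ci≡ear) (toℕ-fromℕ< _))
      j≡2+r : j ≡ 2 + r
      j≡2+r = begin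
        j                                ≡⟨ sym (cycleIndex-cycleLabel middles (m%n<n i (3 + r))) ⟩
        cycleIndex r (cycleLabel r s j)  ≡⟨ cong (cycleIndex r) label≡s′ ⟩
        cycleIndex r s′                  ≡⟨ cycleIndex-ear middles ⟩
        2 + r                            ∎

    at-ear : ∀ {u} → toℕ u ≡ s′ → u ≡ earVertex
    at-ear u≡s′ = toℕ-injective (trans u≡s′ (sym (toℕ-fromℕ< _)))

    theta-spanning : ∀ v → OnCycle (3 + r) thetaCycle v ⊎ v ≡ earVertex
    theta-spanning v with toℕ v ≟ s′
    ... | yes v≡s′ = inj₂ (at-ear v≡s′)
    ... | no v≢s′  = inj₁ (cycleIndex r (toℕ v) , cycleIndex< v<4+r ,
                           thetaCycle-at (<⇒≤ (cycleIndex< v<4+r)) (sym (cycleLabel-cycleIndex middles v<4+r v≢s′)))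
      where
      v<4+r : toℕ v < 4 + r
      v<4+r = subst (toℕ v <_) size≡ (toℕ<n v)

    thetaEarCycle : EarCycle (ThetaSize k) r
    thetaEarCycle = record
      { cyc      = thetaCycle
      ; isCycle  = thetaCycle-isCycle
      ; ear      = earVertex
      ; ear-off  = thetaCycle≢ear
      ; foot₁    = thetaCycle 0
      ; foot₂    = thetaCycle (1 + r)
      ; foot₁-on = 0 , s≤s z≤n , refl
      ; foot₂-on = 1 + r , s≤s (s≤s (n≤1+n r)) , refl
      ; spanning = theta-spanning
      }

    lift-cycleEdge : ∀ {u v} → CycleLabelEdge r s (toℕ u) (toℕ v) → CycleEdge (3 + r) thetaCycle u v
    lift-cycleEdge (i , i<ℓ , u≡ , v≡) = i , i<ℓ , thetaCycle-at (<⇒≤ i<ℓ) u≡ , thetaCycle-at i<ℓ v≡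

    lift-edge : ∀ {u v} → LabelEdge r s s′ (toℕ u) (toℕ v) → EarCycleEdge thetaEarCycle u v
    lift-edge (inj₁ e)                  = along (lift-cycleEdge e)
    lift-edge (inj₂ (u≡s′ , inj₁ v≡0)) = ear₁ (at-ear u≡s′) (thetaCycle-at z≤n v≡0)
    lift-edge (inj₂ (u≡s′ , inj₂ v≡1)) =
      ear₂ (at-ear u≡s′) (thetaCycle-at (m≤n+m (1 + r) 2) (trans v≡1 (sym (cycleLabel-one {r} {s}))))

    adj⇒earCycleEdge : ∀ {u v} → Adj k u v → EarCycleEdge thetaEarCycle u v ⊎ EarCycleEdge thetaEarCycle v u
    adj⇒earCycleEdge (inj₁ e) = Sum.map lift-edge lift-edge (thetaEdge⇒labelEdge 0<r last≡ middles e)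
    adj⇒earCycleEdge (inj₂ e) = Sum.swap (Sum.map lift-edge lift-edge (thetaEdge⇒labelEdge 0<r last≡ middles e))

  adj-onCycle : ∀ {u v} → Adj k u v → Σ ℕ λ s → Σ ℕ λ s′ → Σ (Middles s s′) λ middles →
                CycleEdge (3 + r) (thetaCycle middles) u v ⊎ CycleEdge (3 + r) (thetaCycle middles) v u
  adj-onCycle (inj₁ e) with s , s′ , middles , e′ ← thetaEdge-onCycle 0<r last≡ e =
    s , s′ , middles , Sum.map (lift-cycleEdge middles) (lift-cycleEdge middles) e′
  adj-onCycle (inj₂ e) with s , s′ , middles , e′ ← thetaEdge-onCycle 0<r last≡ e =
    s , s′ , middles , Sum.swap (Sum.map (lift-cycleEdge middles) (lift-cycleEdge middles) e′)

mainTheorem14 : (k m : ℕ) → 2 ≤ k → 4 ≤ m →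
    (L : Fin (ThetaSize k) → List ℕ) → IsAssignment (ThetaSize k) m L →
    (w z : Fin (ThetaSize k)) → Adj k w z →
    (x y : ℕ) → x ∈ L w → x ∉ L z → y ∈ L z → y ∉ L w →
    Σ (List (Vec ℕ (ThetaSize k))) (λ cs →
      Unique cs ×
      ((m ∸ 1) ^ (2 * k ∸ 1) * (m ∸ 2) ^ 2 ≤ length cs) ×
      All (λ f → IsProperLColoring k L f × lookup f w ≡ x × lookup f z ≡ y) cs)
mainTheorem14 k m 2≤k _ L assignment w z wz x y x∈Lw x∉Lz y∈Lz _
  with _ , _ , middles , wz-on-cycle ← Theta.adj-onCycle k (<⇒≤ 2≤k) wz =
  colourings-⊆ L (adj⇒earCycleEdge middles) (orient wz-on-cycle)
  where
  open Theta k (<⇒≤ 2≤k)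
  θ : EarCycle (ThetaSize k) r
  θ = thetaEarCycle middles
  L! : ∀ v → Unique (L v)
  L! = proj₁ ∘ assignment
  L-length : ∀ v → length (L v) ≡ m
  L-length = proj₂ ∘ assignment
  x≢y : x ≢ y
  x≢y refl = x∉Lz y∈Lz
  orient : CycleEdge (3 + r) (thetaCycle middles) w z ⊎ CycleEdge (3 + r) (thetaCycle middles) z w →
           Colourings L (EarCycleEdge θ) w z x y ((m ∸ 1) ^ r * (m ∸ 2) ^ 2)
  orient (inj₁ wz) = earCycle-colourings _≟_ L L! L-length θ wz x∈Lw y∈Lz x≢y
  orient (inj₂ zw) = colourings-swap L (earCycle-colourings _≟_ L L! L-length θ zw y∈Lz x∈Lw (≢-sym x≢y))
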